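{- Let $G$ be a bridgeless cubic graph. Then $G$ has two compatible FR-triples if and only if $G$ has two disjoint matchings $A_1$ and $A_2$ such that $A_1\cup A_2$ forms a union of vertex-disjoint cycles and both $\overline{G_{A_1}}$ and $\overline{G_{A_2}}$ are $3$-edge colourable.
   Context: An FR-triple is an ordered triple $\mathcal T=(M_1,M_2,M_3)$ of perfect matchings of $G$ with $M_1\cap M_2\cap M_3=\emptyset$; $T_i$ ($i=0,1,2$) is the set of edges contained in exactly $i$ of $M_1,M_2,M_3$, and $T'_i$ is defined similarly for $\mathcal T'$. FR-triples $\mathcal T,\mathcal T'$ are compatible if $T_0=T'_2$ and $T_2=T'_0$. Splitting: let $A_1,A_2$ be disjoint matchings of the cubic graph $G$ such that $A_1\cup A_2$ is a union of vertex-disjoint cycles (these alternate between $A_1$ and $A_2$, so every endpoint of an edge of $A_1\cup A_2$ is incident with one edge of $A_1$, one edge of $A_2$, and one further edge, its third edge). For $\{i,j\}=\{1,2\}$, $G_{A_i}$ is obtained from $G$ by, for every edge $ab\in A_i$, replacing $a$ by two new vertices $a'$ (incident with the third edge formerly at $a$) and $a''$ (incident with the $A_j$-edge formerly at $a$), replacing $b$ likewise by $b',b''$, and replacing $ab$ by the two edges $a'b'$ and $a''b''$. $\overline{G_{A_i}}$ is obtained from $G_{A_i}$ by suppressing degree-$2$ vertices: each maximal path whose internal vertices have degree $2$ becomes a single edge, and each cycle all of whose vertices have degree $2$ becomes a vertexless loop (one edge, no vertex). Its components are cubic (multi)graphs and vertexless loops; $\overline{G_{A_i}}$ is called $3$-edge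 colourable if each cubic component is $3$-edge colourable. -}

module Defs where

open import Data.Nat using (ℕ; zero; suc; _+_)
open import Data.Fin using (Fin; zero; suc; _≟_)
open import Data.Bool using (Bool; true; false; _∧_; _∨_; if_then_else_)
open import Data.List using (allFin)
open import Data.Bool.ListAction using (any)
open import Data.Product using (Σ; Σ-syntax; ∃; ∃-syntax; _×_; _,_; proj₁; proj₂)
open import Data.Empty using (⊥)
open import Relation.Nullary using (¬_)
open import Relation.Nullary.Decidable using (⌊_⌋)
open import Relation.Binary.PropositionalEquality using (_≡_; _≢_)
open import Function.Bundles using (_↔_; _⇔_)

-- General (multi)graphs: a vertex type, an edge type, and for each edge
-- its two ends (end e 0, end e 1).  Loops and parallel edges allowed.

record Graph : Set₁ where
  field
    V    : Set
    E    : Set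
    end  : E → Fin 2 → V

open Graph public

-- half-edges at a vertex v (a loop at v contributes two half-edges)
HalfEdge : (K : Graph) → V K → Set
HalfEdge K v = Σ[ e ∈ E K ] Σ[ k ∈ Fin 2 ] (end K e k ≡ v)

edgeOf : {K : Graph} {v : V K} → HalfEdge K v → E K
edgeOf h = proj₁ h

SameHalf : {K : Graph} {v : V K} → HalfEdge K v → HalfEdge K v → Set
SameHalf h h' = (proj₁ h ≡ proj₁ h') × (proj₁ (proj₂ h) ≡ proj₁ (proj₂ h'))

Degree : (K : Graph) → V K → ℕ → Set
Degree K v d = Fin d ↔ HalfEdge K v

EdgeSet : Graph → Set
EdgeSet K = E K → Bool

HalfEdgeIn : (K : Graph) → EdgeSet K → V K → Set
HalfEdgeIn K S v = Σ[ h ∈ HalfEdge K v ] (S (edgeOf h) ≡ true)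

Cubic : Graph → Set
Cubic K = ∀ v → Degree K v 3

-- matching: at most one half-edge of S at each vertex (excludes loops and
-- edges sharing a vertex)
IsMatching : (K : Graph) → EdgeSet K → Set
IsMatching K S = ∀ v (h h' : HalfEdgeIn K S v) → SameHalf (proj₁ h) (proj₁ h')

IsPerfectMatching : (K : Graph) → EdgeSet K → Set
IsPerfectMatching K S = ∀ v → Fin 1 ↔ HalfEdgeIn K S v

data ReachAvoid (K : Graph) (e : E K) : V K → V K → Set where
  here  : ∀ {u} → ReachAvoid K e u u
  step₀ : ∀ {w} (f : E K) → f ≢ e →
          ReachAvoid K e (end K f (suc zero)) w → ReachAvoid K e (end K f zero) w
  step₁ : ∀ {w} (f : E K) → f ≢ e →
          ReachAvoid K e (end K f zero) w → ReachAvoid K e (end K f (suc zero)) w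

Bridgeless : Graph → Set
Bridgeless K = ∀ e → ReachAvoid K e (end K e zero) (end K e (suc zero))

b2n : Bool → ℕ
b2n true  = 1
b2n false = 0

record Triple (K : Graph) : Set where
  constructor triple
  field
    M₁ M₂ M₃ : EdgeSet K

mult : {K : Graph} → Triple K → E K → ℕ
mult (triple M₁ M₂ M₃) e = b2n (M₁ e) + b2n (M₂ e) + b2n (M₃ e)

InT : {K : Graph} → Triple K → ℕ → E K → Set
InT t i e = mult t e ≡ i

IsFRTriple : (K : Graph) → Triple K → Set
IsFRTriple K (triple M₁ M₂ M₃) =
  IsPerfectMatching K M₁ × IsPerfectMatching K M₂ × IsPerfectMatching K M₃ ×
  (∀ e → ¬ ((M₁ e ≡ true) × (M₂ e ≡ true) × (M₃ e ≡ true)))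

Compatible : (K : Graph) → Triple K → Triple K → Set
Compatible K t t' =
  (∀ e → InT t 0 e ⇔ InT t' 2 e) × (∀ e → InT t 2 e ⇔ InT t' 0 e)

HasTwoCompatibleFRTriples : Graph → Set
HasTwoCompatibleFRTriples K =
  Σ[ t ∈ Triple K ] Σ[ t' ∈ Triple K ]
    (IsFRTriple K t × IsFRTriple K t' × Compatible K t t')

_∪ₑ_ : {K : Graph} → EdgeSet K → EdgeSet K → EdgeSet K
(A ∪ₑ B) e = A e ∨ B e

Disjoint : {K : Graph} → EdgeSet K → EdgeSet K → Set
Disjoint {K} A B = ∀ (e : E K) → ¬ ((A e ≡ true) × (B e ≡ true))

-- the subgraph formed by S is a union of vertex-disjoint cycles, i.e. it is
-- 2-regular: every vertex it touches has exactly two half-edges of S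
UnionOfDisjointCycles : (K : Graph) → EdgeSet K → Set
UnionOfDisjointCycles K S = ∀ v → HalfEdgeIn K S v → Fin 2 ↔ HalfEdgeIn K S v

mkGraph : (n m : ℕ) → (Fin m → Fin 2 → Fin n) → Graph
mkGraph n m ends = record { V = Fin n ; E = Fin m ; end = ends }

-- Splitting G along a matching A (playing A_i) with partner B (playing A_j)
--
-- Vertices of G_A : pairs (v , c) with c : Fin 2 if v is covered by A
--   (c = 0 is v', c = 1 is v''), c : Fin 1 otherwise (v itself).
-- Edges of G_A : pairs (e , c) with c : Fin 2 if e ∈ A
--   (c = 0 is the copy a'b', c = 1 is the copy a''b''), c : Fin 1 otherwise.

copies : Bool → ℕ
copies true  = 2
copies false = 1

widen : (b : Bool) → Fin (copies b) → Fin 2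
widen true  i = i
widen false _ = zero

pick : (b : Bool) → Fin 2 → Fin (copies b)
pick true  i = i
pick false _ = zero

module _ {n m : ℕ} (ends : Fin m → Fin 2 → Fin n) where

  coveredᵇ : (Fin m → Bool) → Fin n → Bool
  coveredᵇ A v =
    any (λ e → A e ∧ (⌊ ends e zero ≟ v ⌋ ∨ ⌊ ends e (suc zero) ≟ v ⌋)) (allFin m)

  Split : (A B : Fin m → Bool) → Graph
  Split A B = record
    { V   = Σ[ v ∈ Fin n ] Fin (copies (coveredᵇ A v))
    ; E   = Σ[ e ∈ Fin m ] Fin (copies (A e))
    ; end = λ { (e , c) k →
          let x = ends e k in
          x , pick (coveredᵇ A x)
                   (if A e then widen (A e) c           -- copy a'b' / a''b''
                    else if B e then suc zero            -- B-edge goes to x''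
                    else zero) }                         -- third edge goes to x'
    }

-- 3-edge-colourability of the graph obtained from K by suppressing the
-- degree-2 vertices.  An edge of the suppressed graph is a maximal path /
-- cycle of K through degree-2 vertices, so a 3-edge-colouring of it is a
-- map c : E K → Fin 3 constant across every degree-2 vertex, such that the
-- half-edges at each degree-3 vertex receive pairwise distinct colours
-- (vertexless loops impose no constraint).  This is used only for K = G_A,
-- all of whose vertices have degree 2 or 3.

SuppressedColouring : (K : Graph) → (E K → Fin 3) → Set
SuppressedColouring K c = ∀ v →
  (Degree K v 2 → (h h' : HalfEdge K v) → c (edgeOf h) ≡ c (edgeOf h')) ×
  (Degree K v 3 → (h h' : HalfEdge K v) → c (edgeOf h) ≡ c (edgeOf h') → SameHalf h h')

SuppressedThreeEdgeColourable : Graph → Set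
SuppressedThreeEdgeColourable K = Σ[ c ∈ (E K → Fin 3) ] SuppressedColouring K c

-- At a vertex, the three perfect matchings of an FR-triple sit on its three half-edges, not all
-- on the same one.  A finite check shows that the vertex then meets at most one T₀-edge and at
-- most one T₂-edge, and meets both as soon as it meets either; so T₀ and T₂ are disjoint matchings
-- whose union is a union of cycles, and compatible triples 𝒯, 𝒯′ give A₁ = T₀ = T′₂ and
-- A₂ = T₂ = T′₀.  Split along the T₂-edges and colour every edge on the x′ side by the index k of
-- the matching it alone lies in, or alone misses: at a split vertex the T₂-edge and the third edge
-- get the same colour, at an unsplit vertex the three T₁-edges get distinct colours.  Conversely,
-- a colouring of the suppressed G_{A_i} yields the triple whose k-th matching consists of the
-- A_i-edges not coloured k and the edges outside A_i ∪ A_j coloured k.  Its T₂ is A_i and its T₀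
-- is A_j, so the two splittings give two compatible FR-triples.

module Submission where

open import Defs
open import Data.Nat using (ℕ; zero; suc; _+_; _≡ᵇ_)
open import Data.Nat.Properties using (≡ᵇ⇒≡; ≡⇒≡ᵇ; n<1+n) renaming (_≟_ to _≟ℕ_)
open import Data.Fin using (Fin; zero; suc; _≟_; punchOut)
open import Data.Fin.Properties using (any?; all?; punchOut-injective; <⇒notInjective)
open import Data.Fin.Permutation using (↔⇒≡)
open import Data.Bool using (Bool; true; false; _∧_; _∨_; not; T; if_then_else_)
open import Data.Bool.Properties
  using (¬-not; ∨-comm; ∨-zeroʳ; T-≡; T-∧; T-∨) renaming (_≟_ to _≟ᵇ_)
open import Data.Empty using (⊥)
open import Data.List using (allFin)
open import Data.List.Membership.Propositional using (lose)
open import Data.List.Membership.Propositional.Properties using (∈-allFin)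
open import Data.List.Relation.Unary.Any using (satisfied)
open import Data.List.Relation.Unary.Any.Properties using (any⁺; any⁻)
open import Data.Product using (Σ-syntax; _×_; _,_; proj₁; proj₂) renaming (swap to ×-swap)
open import Data.Product.Properties using (≡-dec)
open import Data.Sum using (_⊎_; inj₁; inj₂; [_,_]) renaming (swap to ⊎-swap)
open import Function using (_∘_)
open import Function.Bundles using (_↔_; _⇔_; Inverse; Equivalence; mk↔ₛ′; mk⇔)
open import Function.Construct.Composition using (_⇔-∘_)
open import Function.Construct.Symmetry using (⇔-sym)
open import Function.Definitions using (Injective)
open import Function.Properties.Inverse using (↔-sym; ↔-trans)
open import Relation.Nullary using (¬_; Dec; yes; no; contradiction)
open import Relation.Nullary.Decidable
  using (⌊_⌋; from-yes; toWitness; fromWitness; ¬?; _×-dec_; _⊎-dec_; _→-dec_)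
open import Relation.Binary using (DecidableEquality)
open import Relation.Binary.PropositionalEquality hiding ([_])
open import Axiom.UniquenessOfIdentityProofs using (module Decidable⇒UIP)

∨-≡-false : ∀ {x y} → x ∨ y ≡ false → x ≡ false × y ≡ false
∨-≡-false {false} {false} _ = refl , refl

toWitness≡ : ∀ {P : Set} {d : Dec P} → ⌊ d ⌋ ≡ true → P
toWitness≡ q = toWitness (Equivalence.from T-≡ q)

fromWitness≡ : ∀ {P : Set} {d : Dec P} → P → ⌊ d ⌋ ≡ true
fromWitness≡ p = Equivalence.to T-≡ (fromWitness p)

injective⇒surjective : ∀ {n} {f : Fin n → Fin n} → Injective _≡_ _≡_ f →
  ∀ k → Σ[ i ∈ Fin n ] f i ≡ k
injective⇒surjective {suc n} {f} f-inj k with any? (λ i → f i ≟ k)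
... | yes hit = hit
... | no miss = contradiction (λ {i} {j} → squeezed {i} {j}) (<⇒notInjective (n<1+n n))
  where
  k≢f : ∀ i → k ≢ f i
  k≢f i k≡fi = miss (i , sym k≡fi)
  squeezed : Injective _≡_ _≡_ (λ i → punchOut (k≢f i))
  squeezed eq = f-inj (punchOut-injective (k≢f _) (k≢f _) eq)

degree-unique : ∀ {K : Graph} {x d d′} → Degree K x d → Degree K x d′ → d ≡ d′
degree-unique δ δ′ = ↔⇒≡ (↔-trans δ (↔-sym δ′))

≡⇒SameHalf : ∀ {K : Graph} {v} {h h′ : HalfEdge K v} → h ≡ h′ → SameHalf h h′
≡⇒SameHalf refl = refl , refl

SameHalf⇒≡ : ∀ {K : Graph} → DecidableEquality (V K) →
  ∀ {v} {h h′ : HalfEdge K v} → SameHalf h h′ → h ≡ h′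
SameHalf⇒≡ _≟ᵥ_ {h = e , k , p} {.e , .k , p′} (refl , refl) =
  cong (λ p → e , k , p) (Decidable⇒UIP.≡-irrelevant _≟ᵥ_ p p′)

Σ-≡-true : ∀ {X : Set} {P : X → Bool} {x y : X} {p : P x ≡ true} {q : P y ≡ true} →
  x ≡ y → _≡_ {A = Σ[ z ∈ X ] P z ≡ true} (x , p) (y , q)
Σ-≡-true refl = cong (_ ,_) (Decidable⇒UIP.≡-irrelevant _≟ᵇ_ _ _)

-- Boolean triples indexed by the three half-edges at a vertex

AtMostOne ExactlyOne ExactlyTwo : (Fin 3 → Bool) → Set
AtMostOne β = ∀ i j → β i ≡ true → β j ≡ true → i ≡ j
ExactlyOne β = Σ[ p ∈ Fin 3 ] β p ≡ true × (∀ i → β i ≡ true → i ≡ p)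
ExactlyTwo β = Σ[ a ∈ Fin 3 ] Σ[ b ∈ Fin 3 ]
  a ≢ b × β a ≡ true × β b ≡ true × (∀ i → β i ≡ true → i ≡ a ⊎ i ≡ b)

module _ {β β′ : Fin 3 → Bool} (β≗β′ : β ≗ β′) where

  private
    back : ∀ {i} → β′ i ≡ true → β i ≡ true
    back {i} = trans (β≗β′ i)

  AtMostOne-resp : AtMostOne β → AtMostOne β′
  AtMostOne-resp amo i j βi βj = amo i j (back βi) (back βj)

  ExactlyOne-resp : ExactlyOne β → ExactlyOne β′
  ExactlyOne-resp (p , βp , unique) = p , trans (sym (β≗β′ p)) βp , λ i βi → unique i (back βi)

  ExactlyTwo-resp : ExactlyTwo β → ExactlyTwo β′
  ExactlyTwo-resp (a , b , a≢b , βa , βb , cover) =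
    a , b , a≢b , trans (sym (β≗β′ a)) βa , trans (sym (β≗β′ b)) βb ,
    λ i βi → cover i (back βi)

Distinct₃ : Fin 3 → Fin 3 → Fin 3 → Set
Distinct₃ a b t = a ≢ b × a ≢ t × b ≢ t

distinct₃-cover : ∀ {a b t} → Distinct₃ a b t → ∀ i → i ≡ a ⊎ i ≡ b ⊎ i ≡ t
distinct₃-cover {a} {b} {t} = from-yes decision a b t
  where
  decision : Dec (∀ (a b t : Fin 3) → Distinct₃ a b t → ∀ i → i ≡ a ⊎ i ≡ b ⊎ i ≡ t)
  decision = all? λ a → all? λ b → all? λ t →
    (¬? (a ≟ b) ×-dec ¬? (a ≟ t) ×-dec ¬? (b ≟ t)) →-dec
    all? λ i → (i ≟ a) ⊎-dec (i ≟ b) ⊎-dec (i ≟ t)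

third-slot : ∀ {a b} → a ≢ b → Σ[ t ∈ Fin 3 ] Distinct₃ a b t
third-slot {a} {b} = from-yes decision a b
  where
  decision : Dec (∀ (a b : Fin 3) → a ≢ b → Σ[ t ∈ Fin 3 ] Distinct₃ a b t)
  decision = all? λ a → all? λ b → ¬? (a ≟ b) →-dec
    any? λ t → ¬? (a ≟ b) ×-dec ¬? (a ≟ t) ×-dec ¬? (b ≟ t)

distinct₃-swap : ∀ {a b t} → Distinct₃ a b t → Distinct₃ b a t
distinct₃-swap (a≢b , a≢t , b≢t) = a≢b ∘ sym , b≢t , a≢t

distinct₃-reverse : ∀ {a b t} → Distinct₃ a b t → Distinct₃ t b a
distinct₃-reverse (a≢b , a≢t , b≢t) = b≢t ∘ sym , a≢t ∘ sym , a≢b ∘ sym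

exactlyOne-at : ∀ {β a b t} → Distinct₃ a b t →
  β a ≡ true → β b ≡ false → β t ≡ false → ExactlyOne β
exactlyOne-at {β} {a} {b} {t} distinct βa βb βt = a , βa , unique
  where
  unique : ∀ i → β i ≡ true → i ≡ a
  unique i βi with distinct₃-cover distinct i
  ... | inj₁ i≡a = i≡a
  ... | inj₂ (inj₁ refl) = contradiction (trans (sym βi) βb) λ ()
  ... | inj₂ (inj₂ refl) = contradiction (trans (sym βi) βt) λ ()

partner : ∀ {β a} → ExactlyTwo β → β a ≡ true →
  Σ[ b ∈ Fin 3 ] a ≢ b × β b ≡ true × (∀ i → β i ≡ true → i ≡ a ⊎ i ≡ b)
partner {a = a} (x , y , x≢y , βx , βy , cover) βa with cover a βa
... | inj₁ refl = y , x≢y , βy , cover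
... | inj₂ refl = x , x≢y ∘ sym , βx , λ i βi → ⊎-swap (cover i βi)

unsplitCopy : Bool → Fin 2
unsplitCopy b = if b then suc zero else zero

record Covered (α β : Fin 3 → Bool) : Set where
  field
    a b t    : Fin 3
    distinct : Distinct₃ a b t
    α-a : α a ≡ true
    β-a : β a ≡ false
    α-b : α b ≡ false
    β-b : β b ≡ true
    α-t : α t ≡ false
    β-t : β t ≡ false

  α-unique : ∀ i → α i ≡ true → i ≡ a
  α-unique = proj₂ (proj₂ (exactlyOne-at distinct α-a α-b α-t))

  β-unique : ∀ i → β i ≡ true → i ≡ b
  β-unique = proj₂ (proj₂ (exactlyOne-at (distinct₃-swap distinct) β-b β-a β-t))

  neither⇒t : ∀ i → α i ≡ false → β i ≡ false → i ≡ t
  neither⇒t i αi βi with distinct₃-cover distinct i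
  ... | inj₁ refl = contradiction (trans (sym αi) α-a) λ ()
  ... | inj₂ (inj₁ refl) = contradiction (trans (sym βi) β-b) λ ()
  ... | inj₂ (inj₂ i≡t) = i≡t

  -- The slot of the unsplit edge at the j-th copy of a split vertex: t at v′, b at v″.
  unsplitSlot : Fin 2 → Fin 3
  unsplitSlot zero       = t
  unsplitSlot (suc zero) = b

  α-unsplitSlot : ∀ j → α (unsplitSlot j) ≡ false
  α-unsplitSlot zero       = α-t
  α-unsplitSlot (suc zero) = α-b

  unsplitCopy-unsplitSlot : ∀ j → unsplitCopy (β (unsplitSlot j)) ≡ j
  unsplitCopy-unsplitSlot zero       = cong unsplitCopy β-t
  unsplitCopy-unsplitSlot (suc zero) = cong unsplitCopy β-b

  unsplitSlot-unique : ∀ {i} j → α i ≡ false → unsplitCopy (β i) ≡ j → i ≡ unsplitSlot j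
  unsplitSlot-unique {i} j αi copy with β i in βi
  unsplitSlot-unique {i} zero       αi _ | false = neither⇒t i αi βi
  unsplitSlot-unique {i} (suc zero) αi _ | true  = β-unique i βi

Uncovered : (α β : Fin 3 → Bool) → Set
Uncovered α β = ∀ i → α i ≡ false × β i ≡ false

Configuration : (α β : Fin 3 → Bool) → Set
Configuration α β = Uncovered α β ⊎ Covered α β

swap-configuration : ∀ {α β} → Configuration α β → Configuration β α
swap-configuration (inj₁ uncovered) = inj₁ λ i → ×-swap (uncovered i)
swap-configuration (inj₂ c) = inj₂ record
  { a = b ; b = a ; t = t
  ; distinct = distinct₃-swap distinct
  ; α-a = β-b ; β-a = α-b ; α-b = β-a ; β-b = α-a ; α-t = β-t ; β-t = α-t }
  where open Covered c

NoneOrTwo : (Fin 3 → Bool) → Set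
NoneOrTwo γ = ∀ i → γ i ≡ true → ExactlyTwo γ

module _ {α β : Fin 3 → Bool} (α-amo : AtMostOne α) (β-amo : AtMostOne β)
         (disjoint : ∀ i → ¬ (α i ≡ true × β i ≡ true))
         (two : NoneOrTwo (λ i → α i ∨ β i)) where

  covered-at : ∀ {a} → α a ≡ true → Covered α β
  covered-at {a} αa with partner (two a (cong (_∨ β a) αa)) (cong (_∨ β a) αa)
  ... | b , a≢b , γb , a-or-b with third-slot a≢b
  ... | t , distinct@(_ , a≢t , b≢t) = record
    { a = a ; b = b ; t = t ; distinct = distinct
    ; α-a = αa ; β-a = ¬-not λ βa → disjoint a (αa , βa)
    ; α-b = α-b ; β-b = subst (λ x → x ∨ β b ≡ true) α-b γb
    ; α-t = proj₁ (∨-≡-false γt) ; β-t = proj₂ (∨-≡-false γt) }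
    where
    α-b : α b ≡ false
    α-b = ¬-not λ αb → a≢b (α-amo a b αa αb)
    γt : α t ∨ β t ≡ false
    γt = ¬-not λ γt → [ a≢t ∘ sym , b≢t ∘ sym ] (a-or-b t γt)

configuration : ∀ {α β : Fin 3 → Bool} → AtMostOne α → AtMostOne β →
  (∀ i → ¬ (α i ≡ true × β i ≡ true)) → NoneOrTwo (λ i → α i ∨ β i) → Configuration α β
configuration {α} {β} α-amo β-amo disjoint two
  with any? (λ i → α i ≟ᵇ true) | any? (λ i → β i ≟ᵇ true)
... | yes (_ , αa) | _ = inj₂ (covered-at α-amo β-amo disjoint two αa)
... | no _ | yes (_ , βb) = swap-configuration (inj₂ (covered-at β-amo α-amo disjoint′ two′ βb))
  where
  disjoint′ : ∀ i → ¬ (β i ≡ true × α i ≡ true)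
  disjoint′ i (βi , αi) = disjoint i (αi , βi)
  two′ : NoneOrTwo (λ i → β i ∨ α i)
  two′ i γi = ExactlyTwo-resp (λ j → ∨-comm (α j) (β j)) (two i (trans (∨-comm (α i) (β i)) γi))
... | no no-α | no no-β =
  inj₁ λ i → ¬-not (λ αi → no-α (i , αi)) , ¬-not (λ βi → no-β (i , βi))

atMostOne? : ∀ β → Dec (AtMostOne β)
atMostOne? β = all? λ i → all? λ j → (β i ≟ᵇ true) →-dec (β j ≟ᵇ true) →-dec (i ≟ j)

exactlyTwo? : ∀ β → Dec (ExactlyTwo β)
exactlyTwo? β = any? λ a → any? λ b →
  ¬? (a ≟ b) ×-dec (β a ≟ᵇ true) ×-dec (β b ≟ᵇ true) ×-dec
  all? λ i → (β i ≟ᵇ true) →-dec ((i ≟ a) ⊎-dec (i ≟ b))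

Support : (Fin 3 → Bool) → Set
Support β = Σ[ i ∈ Fin 3 ] β i ≡ true

module _ {β : Fin 3 → Bool} where

  exactlyOne⇒↔ : ExactlyOne β → Fin 1 ↔ Support β
  exactlyOne⇒↔ (p , βp , unique) =
    mk↔ₛ′ (λ _ → p , βp) (λ _ → zero)
          (λ (i , βi) → Σ-≡-true (sym (unique i βi))) λ { zero → refl }

  ↔⇒exactlyOne : Fin 1 ↔ Support β → ExactlyOne β
  ↔⇒exactlyOne ι = proj₁ (to zero) , proj₂ (to zero) , unique
    where
    open Inverse ι
    unique : ∀ i → β i ≡ true → i ≡ proj₁ (to zero)
    unique i βi with from (i , βi) in eq
    ... | zero = cong proj₁ (trans (sym (strictlyInverseˡ (i , βi))) (cong to eq))

  exactlyTwo⇒↔ : ExactlyTwo β → Fin 2 ↔ Support β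
  exactlyTwo⇒↔ (a , b , a≢b , βa , βb , cover) = mk↔ₛ′ to from to∘from from∘to
    where
    to : Fin 2 → Support β
    to zero = a , βa
    to (suc zero) = b , βb
    from : Support β → Fin 2
    from (i , _) with i ≟ a
    ... | yes _ = zero
    ... | no _ = suc zero
    to∘from : ∀ x → to (from x) ≡ x
    to∘from (i , βi) with i ≟ a | cover i βi
    ... | yes i≡a | _ = Σ-≡-true (sym i≡a)
    ... | no i≢a | inj₁ i≡a = contradiction i≡a i≢a
    ... | no _ | inj₂ i≡b = Σ-≡-true (sym i≡b)
    from∘to : ∀ j → from (to j) ≡ j
    from∘to zero with a ≟ a
    ... | yes _ = refl
    ... | no a≢a = contradiction refl a≢a
    from∘to (suc zero) with b ≟ a
    ... | yes b≡a = contradiction (sym b≡a) a≢b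
    ... | no _ = refl

  ↔⇒exactlyTwo : Fin 2 ↔ Support β → ExactlyTwo β
  ↔⇒exactlyTwo ι =
    proj₁ (to zero) , proj₁ (to (suc zero)) , a≢b , proj₂ (to zero) , proj₂ (to (suc zero)) , cover
    where
    open Inverse ι
    a≢b : proj₁ (to zero) ≢ proj₁ (to (suc zero))
    a≢b eq with () ← trans (sym (strictlyInverseʳ zero))
                      (trans (cong from (Σ-≡-true eq)) (strictlyInverseʳ (suc zero)))
    cover : ∀ i → β i ≡ true → i ≡ proj₁ (to zero) ⊎ i ≡ proj₁ (to (suc zero))
    cover i βi with from (i , βi) in eq
    ... | zero = inj₁ (cong proj₁ (trans (sym (strictlyInverseˡ (i , βi))) (cong to eq)))
    ... | suc zero = inj₂ (cong proj₁ (trans (sym (strictlyInverseˡ (i , βi))) (cong to eq)))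

injective⇒exactlyOne : ∀ {x : Fin 3 → Fin 3} → Injective _≡_ _≡_ x →
  ∀ k → ExactlyOne (λ i → ⌊ x i ≟ k ⌋)
injective⇒exactlyOne x-inj k with injective⇒surjective x-inj k
... | p , xp≡k = p , fromWitness≡ xp≡k , λ i xi≡k → x-inj (trans (toWitness≡ xi≡k) (sym xp≡k))

exactlyOne-indicator : ∀ {β} (one : ExactlyOne β) → ∀ i → β i ≡ ⌊ i ≟ proj₁ one ⌋
exactlyOne-indicator {β} (p , βp , unique) i with i ≟ p
... | yes refl = βp
... | no i≢p = ¬-not λ βi → i≢p (unique i βi)

-- The local structure of an FR-triple at a vertex

-- An edge lying in Mₖ only, or in every matching but Mₖ, gets colour k (counting from 0).
tripleColour : Bool → Bool → Bool → Fin 3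
tripleColour true  true  _     = suc (suc zero)
tripleColour true  false true  = suc zero
tripleColour true  false false = zero
tripleColour false true  true  = zero
tripleColour false true  false = suc zero
tripleColour false false true  = suc (suc zero)
tripleColour false false false = zero

NotAllEqual : Fin 3 → Fin 3 → Fin 3 → Set
NotAllEqual p₁ p₂ p₃ = ¬ (p₁ ≡ p₂ × p₂ ≡ p₃)

profileMult : Fin 3 → Fin 3 → Fin 3 → Fin 3 → ℕ
profileMult p₁ p₂ p₃ i = b2n ⌊ i ≟ p₁ ⌋ + b2n ⌊ i ≟ p₂ ⌋ + b2n ⌊ i ≟ p₃ ⌋

profileColour : Fin 3 → Fin 3 → Fin 3 → Fin 3 → Fin 3
profileColour p₁ p₂ p₃ i = tripleColour ⌊ i ≟ p₁ ⌋ ⌊ i ≟ p₂ ⌋ ⌊ i ≟ p₃ ⌋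

notAllEqual? : ∀ p₁ p₂ p₃ → Dec (NotAllEqual p₁ p₂ p₃)
notAllEqual? p₁ p₂ p₃ = ¬? ((p₁ ≟ p₂) ×-dec (p₂ ≟ p₃))

profile-T₀-atMostOne : ∀ p₁ p₂ p₃ → NotAllEqual p₁ p₂ p₃ →
  AtMostOne (λ i → profileMult p₁ p₂ p₃ i ≡ᵇ 0)
profile-T₀-atMostOne = from-yes decision
  where
  decision : Dec (∀ p₁ p₂ p₃ → NotAllEqual p₁ p₂ p₃ →
                  AtMostOne (λ i → profileMult p₁ p₂ p₃ i ≡ᵇ 0))
  decision = all? λ p₁ → all? λ p₂ → all? λ p₃ → notAllEqual? p₁ p₂ p₃ →-dec atMostOne? _

profile-T₂-atMostOne : ∀ p₁ p₂ p₃ → NotAllEqual p₁ p₂ p₃ →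
  AtMostOne (λ i → profileMult p₁ p₂ p₃ i ≡ᵇ 2)
profile-T₂-atMostOne = from-yes decision
  where
  decision : Dec (∀ p₁ p₂ p₃ → NotAllEqual p₁ p₂ p₃ →
                  AtMostOne (λ i → profileMult p₁ p₂ p₃ i ≡ᵇ 2))
  decision = all? λ p₁ → all? λ p₂ → all? λ p₃ → notAllEqual? p₁ p₂ p₃ →-dec atMostOne? _

profile-T₀∪T₂-noneOrTwo : ∀ p₁ p₂ p₃ → NotAllEqual p₁ p₂ p₃ →
  NoneOrTwo (λ i → (profileMult p₁ p₂ p₃ i ≡ᵇ 0) ∨ (profileMult p₁ p₂ p₃ i ≡ᵇ 2))
profile-T₀∪T₂-noneOrTwo = from-yes decision
  where
  T₀∪T₂ : Fin 3 → Fin 3 → Fin 3 → Fin 3 → Bool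
  T₀∪T₂ p₁ p₂ p₃ i = (profileMult p₁ p₂ p₃ i ≡ᵇ 0) ∨ (profileMult p₁ p₂ p₃ i ≡ᵇ 2)
  decision : Dec (∀ p₁ p₂ p₃ → NotAllEqual p₁ p₂ p₃ → NoneOrTwo (T₀∪T₂ p₁ p₂ p₃))
  decision = all? λ p₁ → all? λ p₂ → all? λ p₃ → notAllEqual? p₁ p₂ p₃ →-dec
    all? λ i → (T₀∪T₂ p₁ p₂ p₃ i ≟ᵇ true) →-dec exactlyTwo? _

profile-colour-T₂≡non-T₀ : ∀ p₁ p₂ p₃ a i →
  profileMult p₁ p₂ p₃ a ≡ 2 → profileMult p₁ p₂ p₃ i ≢ 0 →
  profileColour p₁ p₂ p₃ a ≡ profileColour p₁ p₂ p₃ i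
profile-colour-T₂≡non-T₀ = from-yes decision
  where
  decision : Dec (∀ p₁ p₂ p₃ a i →
                  profileMult p₁ p₂ p₃ a ≡ 2 → profileMult p₁ p₂ p₃ i ≢ 0 →
                  profileColour p₁ p₂ p₃ a ≡ profileColour p₁ p₂ p₃ i)
  decision = all? λ p₁ → all? λ p₂ → all? λ p₃ → all? λ a → all? λ i →
    (profileMult p₁ p₂ p₃ a ≟ℕ 2) →-dec ¬? (profileMult p₁ p₂ p₃ i ≟ℕ 0) →-dec
    (profileColour p₁ p₂ p₃ a ≟ profileColour p₁ p₂ p₃ i)

profile-colour-injective-on-T₁ : ∀ p₁ p₂ p₃ → NotAllEqual p₁ p₂ p₃ → ∀ i j →
  profileMult p₁ p₂ p₃ i ≢ 0 → profileMult p₁ p₂ p₃ i ≢ 2 →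
  profileMult p₁ p₂ p₃ j ≢ 0 → profileMult p₁ p₂ p₃ j ≢ 2 →
  profileColour p₁ p₂ p₃ i ≡ profileColour p₁ p₂ p₃ j → i ≡ j
profile-colour-injective-on-T₁ = from-yes decision
  where
  decision : Dec (∀ p₁ p₂ p₃ → NotAllEqual p₁ p₂ p₃ → ∀ i j →
    profileMult p₁ p₂ p₃ i ≢ 0 → profileMult p₁ p₂ p₃ i ≢ 2 →
    profileMult p₁ p₂ p₃ j ≢ 0 → profileMult p₁ p₂ p₃ j ≢ 2 →
    profileColour p₁ p₂ p₃ i ≡ profileColour p₁ p₂ p₃ j → i ≡ j)
  decision = all? λ p₁ → all? λ p₂ → all? λ p₃ → notAllEqual? p₁ p₂ p₃ →-dec
    all? λ i → all? λ j →
    ¬? (profileMult p₁ p₂ p₃ i ≟ℕ 0) →-dec ¬? (profileMult p₁ p₂ p₃ i ≟ℕ 2) →-dec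
    ¬? (profileMult p₁ p₂ p₃ j ≟ℕ 0) →-dec ¬? (profileMult p₁ p₂ p₃ j ≟ℕ 2) →-dec
    (profileColour p₁ p₂ p₃ i ≟ profileColour p₁ p₂ p₃ j) →-dec (i ≟ j)

slotMember : (inB inA : Bool) (x k : Fin 3) → Bool
slotMember true  _     _ _ = false
slotMember false true  x k = not ⌊ x ≟ k ⌋
slotMember false false x k = ⌊ x ≟ k ⌋

expectedMult : (inB inA : Bool) → ℕ
expectedMult true  _     = 0
expectedMult false true  = 2
expectedMult false false = 1

slotMember-count : ∀ inB inA x →
  b2n (slotMember inB inA x zero) + b2n (slotMember inB inA x (suc zero)) +
  b2n (slotMember inB inA x (suc (suc zero))) ≡ expectedMult inB inA
slotMember-count true  _     _                = refl
slotMember-count false true  zero             = refl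
slotMember-count false true  (suc zero)       = refl
slotMember-count false true  (suc (suc zero)) = refl
slotMember-count false false zero             = refl
slotMember-count false false (suc zero)       = refl
slotMember-count false false (suc (suc zero)) = refl

expectedMult≡0⇔ : ∀ inB inA → (expectedMult inB inA ≡ 0) ⇔ (inB ≡ true)
expectedMult≡0⇔ true  _     = mk⇔ (λ _ → refl) (λ _ → refl)
expectedMult≡0⇔ false true  = mk⇔ (λ ()) (λ ())
expectedMult≡0⇔ false false = mk⇔ (λ ()) (λ ())

expectedMult≡2⇔ : ∀ inB inA → ¬ (inA ≡ true × inB ≡ true) →
  (expectedMult inB inA ≡ 2) ⇔ (inA ≡ true)
expectedMult≡2⇔ true  true  both = contradiction (refl , refl) both
expectedMult≡2⇔ true  false _    = mk⇔ (λ ()) (λ ())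
expectedMult≡2⇔ false true  _    = mk⇔ (λ _ → refl) (λ _ → refl)
expectedMult≡2⇔ false false _    = mk⇔ (λ ()) (λ ())

expectedMult≢3 : ∀ inB inA → expectedMult inB inA ≢ 3
expectedMult≢3 true  _     ()
expectedMult≢3 false true  ()
expectedMult≢3 false false ()

module CubicSlots {n m : ℕ} (ends : Fin m → Fin 2 → Fin n) (cubic : Cubic (mkGraph n m ends)) where

  G : Graph
  G = mkGraph n m ends

  halfEdgeAt : (v : Fin n) → Fin 3 → HalfEdge G v
  halfEdgeAt v = Inverse.to (cubic v)

  slotOf : ∀ {v} → HalfEdge G v → Fin 3
  slotOf {v} = Inverse.from (cubic v)

  halfEdgeAt-slotOf : ∀ {v} (h : HalfEdge G v) → halfEdgeAt v (slotOf h) ≡ h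
  halfEdgeAt-slotOf {v} = Inverse.strictlyInverseˡ (cubic v)

  slotOf-halfEdgeAt : ∀ v i → slotOf (halfEdgeAt v i) ≡ i
  slotOf-halfEdgeAt v = Inverse.strictlyInverseʳ (cubic v)

  edgeAt : Fin n → Fin 3 → Fin m
  edgeAt v i = edgeOf (halfEdgeAt v i)

  edgeAt-slotOf : ∀ {v} (h : HalfEdge G v) → edgeAt v (slotOf h) ≡ edgeOf h
  edgeAt-slotOf h = cong edgeOf (halfEdgeAt-slotOf h)

  _at_ : EdgeSet G → Fin n → Fin 3 → Bool
  (S at v) i = S (edgeAt v i)

  at-slotOf : ∀ S {v} (h : HalfEdge G v) → (S at v) (slotOf h) ≡ S (edgeOf h)
  at-slotOf S h = cong S (edgeAt-slotOf h)

  halfEdgesIn↔support : ∀ S v → HalfEdgeIn G S v ↔ Support (S at v)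
  halfEdgesIn↔support S v = mk↔ₛ′
    (λ (h , Sh) → slotOf h , trans (at-slotOf S h) Sh)
    (λ (i , Si) → halfEdgeAt v i , Si)
    (λ (i , _) → Σ-≡-true (slotOf-halfEdgeAt v i))
    (λ (h , _) → Σ-≡-true (halfEdgeAt-slotOf h))

  isMatching⇔ : ∀ S → IsMatching G S ⇔ (∀ v → AtMostOne (S at v))
  isMatching⇔ S = mk⇔
    (λ matching v i j Si Sj →
      trans (sym (slotOf-halfEdgeAt v i))
        (trans (cong slotOf (SameHalf⇒≡ _≟_ (matching v (halfEdgeAt v i , Si) (halfEdgeAt v j , Sj))))
               (slotOf-halfEdgeAt v j)))
    (λ amo v (h , Sh) (h′ , Sh′) → ≡⇒SameHalf
      (trans (sym (halfEdgeAt-slotOf h))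
        (trans (cong (halfEdgeAt v) (amo v _ _ (trans (at-slotOf S h) Sh) (trans (at-slotOf S h′) Sh′)))
               (halfEdgeAt-slotOf h′))))

  isPerfectMatching⇔ : ∀ S → IsPerfectMatching G S ⇔ (∀ v → ExactlyOne (S at v))
  isPerfectMatching⇔ S = mk⇔
    (λ perfect v → ↔⇒exactlyOne (↔-trans (perfect v) (halfEdgesIn↔support S v)))
    (λ one v → ↔-trans (exactlyOne⇒↔ (one v)) (↔-sym (halfEdgesIn↔support S v)))

  unionOfDisjointCycles⇔ : ∀ S → UnionOfDisjointCycles G S ⇔ (∀ v → NoneOrTwo (S at v))
  unionOfDisjointCycles⇔ S = mk⇔
    (λ cycles v i Si → ↔⇒exactlyTwo
      (↔-trans (cycles v (halfEdgeAt v i , Si)) (halfEdgesIn↔support S v)))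
    (λ two v (h , Sh) → ↔-trans
      (exactlyTwo⇒↔ (two v (slotOf h) (trans (at-slotOf S h) Sh)))
      (↔-sym (halfEdgesIn↔support S v)))

  configurationAt : ∀ {A B} → IsMatching G A → IsMatching G B → Disjoint {G} A B →
    UnionOfDisjointCycles G (_∪ₑ_ {G} A B) → ∀ v → Configuration (A at v) (B at v)
  configurationAt {A} {B} A-matching B-matching disjoint cycles v = configuration
    (Equivalence.to (isMatching⇔ A) A-matching v) (Equivalence.to (isMatching⇔ B) B-matching v)
    (λ i → disjoint (edgeAt v i)) (Equivalence.to (unionOfDisjointCycles⇔ _) cycles v)

module Splitting {n m : ℕ} (ends : Fin m → Fin 2 → Fin n) (cubic : Cubic (mkGraph n m ends))
                 (A B : EdgeSet (mkGraph n m ends)) where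

  open CubicSlots ends cubic

  SG : Graph
  SG = Split ends A B

  covered : Fin n → Bool
  covered = coveredᵇ ends A

  selector : (e : Fin m) → Fin (copies (A e)) → Fin 2
  selector e c = if A e then widen (A e) c else unsplitCopy (B e)

  copyAt : Fin n → Fin 2 → V SG
  copyAt v j = v , pick (covered v) j

  copyAt-widen : ∀ v c → copyAt v (widen (covered v) c) ≡ (v , c)
  copyAt-widen v c = cong (v ,_) (pick-widen (covered v) c)
    where
    pick-widen : ∀ b (c : Fin (copies b)) → pick b (widen b c) ≡ c
    pick-widen true  c    = refl
    pick-widen false zero = refl

  _≟ˢ_ : DecidableEquality (V SG)
  _≟ˢ_ = ≡-dec _≟_ _≟_

  base : ∀ {v j} → HalfEdge SG (copyAt v j) → HalfEdge G v
  base ((e , _) , k , p) = e , k , cong proj₁ p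

  base-selector : ∀ {v j} (x : HalfEdge SG (copyAt v j)) →
    pick (covered v) (selector (proj₁ (proj₁ x)) (proj₂ (proj₁ x))) ≡ pick (covered v) j
  base-selector ((e , c) , k , p) = second p
    where
    second : ∀ {w v} {s : Fin 2} {c : Fin (copies (covered v))} →
      _≡_ {A = V SG} (w , pick (covered w) s) (v , c) → pick (covered v) s ≡ c
    second refl = refl

  lift : ∀ {v j} (h : HalfEdge G v) (c : Fin (copies (A (edgeOf h)))) →
    pick (covered v) (selector (edgeOf h) c) ≡ pick (covered v) j → HalfEdge SG (copyAt v j)
  lift (e , k , p) c q = (e , c) , k , attach p q
    where
    attach : ∀ {w v} {s : Fin 2} {c : Fin (copies (covered v))} → w ≡ v →
      pick (covered v) s ≡ c → _≡_ {A = V SG} (w , pick (covered w) s) (v , c)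
    attach refl q = cong (_ ,_) q

  base-lift : ∀ {v j} (h : HalfEdge G v) c q → base (lift {v} {j} h c q) ≡ h
  base-lift h c q = SameHalf⇒≡ _≟_ (refl , refl)

  meets : Fin m → Fin n → Bool
  meets e v = ⌊ ends e zero ≟ v ⌋ ∨ ⌊ ends e (suc zero) ≟ v ⌋

  incident : ∀ {e v} k → ends e k ≡ v → meets e v ≡ true
  incident {e} {v} zero p =
    cong (_∨ ⌊ ends e (suc zero) ≟ v ⌋) (fromWitness≡ {d = ends e zero ≟ v} p)
  incident {e} {v} (suc zero) p =
    trans (cong (⌊ ends e zero ≟ v ⌋ ∨_) (fromWitness≡ {d = ends e (suc zero) ≟ v} p))
          (∨-zeroʳ _)

  covered-true : ∀ {v} (h : HalfEdge G v) → A (edgeOf h) ≡ true → covered v ≡ true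
  covered-true {v} (e , k , p) Ae = Equivalence.to T-≡
    (any⁺ (λ e → A e ∧ meets e v)
          (lose (∈-allFin e) (Equivalence.from T-≡ (cong₂ _∧_ Ae (incident k p)))))

  covered-false : ∀ {v} → (∀ i → (A at v) i ≡ false) → covered v ≡ false
  covered-false {v} A-free = ¬-not λ cov →
    absurd (satisfied (any⁻ (λ e → A e ∧ meets e v) (allFin m) (Equivalence.from T-≡ cov)))
    where
    clash : (h : HalfEdge G v) → T (A (edgeOf h)) → ⊥
    clash h T-Ah = contradiction
      (trans (sym (A-free (slotOf h))) (trans (cong A (edgeAt-slotOf h)) (Equivalence.to T-≡ T-Ah))) λ ()
    absurd : Σ[ e ∈ Fin m ] T (A e ∧ meets e v) → ⊥
    absurd (e , T-Ae∧meets) with Equivalence.to (T-∧ {A e}) T-Ae∧meets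
    ... | T-Ae , T-meets with Equivalence.to (T-∨ {⌊ ends e zero ≟ v ⌋}) T-meets
    ... | inj₁ end₀ = clash (e , zero , toWitness end₀) T-Ae
    ... | inj₂ end₁ = clash (e , suc zero , toWitness end₁) T-Ae

  widenedCopy : ∀ {u} → HalfEdge SG u → Fin 2
  widenedCopy ((e , c) , _) = widen (A e) c

  widen-injective : ∀ b {c c′ : Fin (copies b)} → widen b c ≡ widen b c′ → c ≡ c′
  widen-injective true  eq = eq
  widen-injective false {zero} {zero} _ = refl

  widen-false : ∀ {b} → b ≡ false → (c : Fin (copies b)) → widen b c ≡ zero
  widen-false refl _ = refl

  widen-pick : ∀ {b} → b ≡ true → (j : Fin 2) → widen b (pick b j) ≡ j
  widen-pick refl _ = refl

  pick-false : ∀ {b} → b ≡ false → {j j′ : Fin 2} → pick b j ≡ pick b j′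
  pick-false refl = refl

  pick-true-injective : ∀ {b} → b ≡ true → {j j′ : Fin 2} → pick b j ≡ pick b j′ → j ≡ j′
  pick-true-injective refl eq = eq

  selector-split : ∀ {e} → A e ≡ true → (c : Fin (copies (A e))) → selector e c ≡ widen (A e) c
  selector-split {e} Ae c with A e
  selector-split refl c | true = refl

  selector-unsplit : ∀ {e} → A e ≡ false → (c : Fin (copies (A e))) →
    selector e c ≡ unsplitCopy (B e)
  selector-unsplit {e} Ae c with A e
  selector-unsplit refl c | false = refl

  split-half-≡ : ∀ {v j} {x y : HalfEdge SG (copyAt v j)} →
    slotOf (base x) ≡ slotOf (base y) → widenedCopy x ≡ widenedCopy y → x ≡ y
  split-half-≡ {x = x} {y} same-slot same-copy =
    SameHalf⇒≡ _≟ˢ_ (same-edge (cong edgeOf same-base) same-copy , cong (proj₁ ∘ proj₂) same-base)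
    where
    same-base : base x ≡ base y
    same-base = trans (sym (halfEdgeAt-slotOf (base x)))
                  (trans (cong (halfEdgeAt _) same-slot) (halfEdgeAt-slotOf (base y)))
    same-edge : ∀ {e e′ c c′} → e ≡ e′ → widen (A e) c ≡ widen (A e′) c′ →
      _≡_ {A = E SG} (e , c) (e′ , c′)
    same-edge refl eq = cong (_ ,_) (widen-injective (A _) eq)

  slotOf-lift : ∀ {v j} i c q → slotOf (base (lift {v} {j} (halfEdgeAt v i) c q)) ≡ i
  slotOf-lift {v} i c q = trans (cong slotOf (base-lift (halfEdgeAt v i) c q)) (slotOf-halfEdgeAt v i)

  uncovered-degree : ∀ {v} j → (∀ i → (A at v) i ≡ false) → Degree SG (copyAt v j) 3
  uncovered-degree {v} j A-free = mk↔ₛ′ to (slotOf ∘ base) to∘from from∘to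
    where
    to : Fin 3 → HalfEdge SG (copyAt v j)
    to i = lift (halfEdgeAt v i) (pick (A (edgeAt v i)) zero) (pick-false (covered-false A-free))
    from∘to : ∀ i → slotOf (base (to i)) ≡ i
    from∘to i = slotOf-lift i _ _
    to∘from : ∀ x → to (slotOf (base x)) ≡ x
    to∘from x = split-half-≡ (from∘to (slotOf (base x)))
      (trans (widen-false (A-free _) _)
             (sym (widen-false (trans (sym (at-slotOf A (base x))) (A-free (slotOf (base x)))) _)))

  covered-degree : ∀ {v} j → Covered (A at v) (B at v) → Degree SG (copyAt v j) 2
  covered-degree {v} j cov = mk↔ₛ′ to from to∘from from∘to
    where
    open Covered cov
    v-covered : covered v ≡ true
    v-covered = covered-true (halfEdgeAt v a) α-a

    to : Fin 2 → HalfEdge SG (copyAt v j)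
    to zero = lift (halfEdgeAt v a) (pick (A (edgeAt v a)) j)
      (cong (pick (covered v)) (trans (selector-split α-a _) (widen-pick α-a j)))
    to (suc zero) = lift (halfEdgeAt v (unsplitSlot j)) (pick (A (edgeAt v (unsplitSlot j))) zero)
      (cong (pick (covered v)) (trans (selector-unsplit (α-unsplitSlot j) _) (unsplitCopy-unsplitSlot j)))

    from : HalfEdge SG (copyAt v j) → Fin 2
    from x = if A (proj₁ (proj₁ x)) then zero else suc zero

    from∘to : ∀ i → from (to i) ≡ i
    from∘to zero       = cong (if_then zero else suc zero) α-a
    from∘to (suc zero) = cong (if_then zero else suc zero) (α-unsplitSlot j)

    split-copy : ∀ x → A (proj₁ (proj₁ x)) ≡ true → to zero ≡ x
    split-copy x@((e , c) , _) Ae = split-half-≡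
      (trans (slotOf-lift a _ _) (sym (α-unique _ (trans (at-slotOf A (base x)) Ae))))
      (trans (widen-pick α-a j)
             (sym (trans (sym (selector-split Ae c)) (pick-true-injective v-covered (base-selector x)))))

    unsplit-edge : ∀ x → A (proj₁ (proj₁ x)) ≡ false → to (suc zero) ≡ x
    unsplit-edge x@((e , c) , _) Ae = split-half-≡
      (trans (slotOf-lift (unsplitSlot j) _ _) (sym (unsplitSlot-unique j (trans (at-slotOf A (base x)) Ae)
        (trans (cong unsplitCopy (at-slotOf B (base x)))
               (trans (sym (selector-unsplit Ae c)) (pick-true-injective v-covered (base-selector x)))))))
      (trans (widen-false (α-unsplitSlot j) _) (sym (widen-false Ae c)))

    to∘from : ∀ x → to (from x) ≡ x
    to∘from x = by-side (A (proj₁ (proj₁ x))) refl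
      where
      by-side : ∀ s → A (proj₁ (proj₁ x)) ≡ s → to (from x) ≡ x
      by-side true  Ae = trans (cong (λ s → to (if s then zero else suc zero)) Ae) (split-copy x Ae)
      by-side false Ae = trans (cong (λ s → to (if s then zero else suc zero)) Ae) (unsplit-edge x Ae)

  at-every-copy : (P : V SG → Set) → (∀ v j → P (copyAt v j)) → ∀ x → P x
  at-every-copy P p (v , c) = subst P (copyAt-widen v c) (p v (widen (covered v) c))

module FRProfiles {n m : ℕ} (ends : Fin m → Fin 2 → Fin n) (cubic : Cubic (mkGraph n m ends)) where

  open CubicSlots ends cubic
  open Equivalence

  edgeColour : Triple G → Fin m → Fin 3
  edgeColour (triple M₁ M₂ M₃) e = tripleColour (M₁ e) (M₂ e) (M₃ e)

  inExactly : Triple G → ℕ → EdgeSet G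
  inExactly s i e = mult s e ≡ᵇ i

  inExactly⇔InT : ∀ s i e → (inExactly s i e ≡ true) ⇔ InT s i e
  inExactly⇔InT s i e = mk⇔ (≡ᵇ⇒≡ _ _ ∘ from T-≡) (to T-≡ ∘ ≡⇒≡ᵇ _ _)

  -- pₖ is the slot at v of the edge of Mₖ.
  record ProfileAt (s : Triple G) (v : Fin n) : Set where
    field
      p₁ p₂ p₃    : Fin 3
      notAllEqual : NotAllEqual p₁ p₂ p₃
      mult-at     : ∀ i → mult s (edgeAt v i) ≡ profileMult p₁ p₂ p₃ i
      colour-at   : ∀ i → edgeColour s (edgeAt v i) ≡ profileColour p₁ p₂ p₃ i

    inExactly-at : ∀ k i → (inExactly s k at v) i ≡ (profileMult p₁ p₂ p₃ i ≡ᵇ k)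
    inExactly-at k i = cong (_≡ᵇ k) (mult-at i)

    T₀∪T₂-at : ∀ i → (_∪ₑ_ {G} (inExactly s 0) (inExactly s 2) at v) i ≡
                     (profileMult p₁ p₂ p₃ i ≡ᵇ 0) ∨ (profileMult p₁ p₂ p₃ i ≡ᵇ 2)
    T₀∪T₂-at i = cong₂ _∨_ (inExactly-at 0 i) (inExactly-at 2 i)

  profileAt : ∀ {s} → IsFRTriple G s → ∀ v → ProfileAt s v
  profileAt {triple M₁ M₂ M₃} (perfect₁ , perfect₂ , perfect₃ , not-all) v = record
    { p₁ = proj₁ one₁ ; p₂ = proj₁ one₂ ; p₃ = proj₁ one₃
    ; notAllEqual = λ (p₁≡p₂ , p₂≡p₃) → not-all (edgeAt v (proj₁ one₁))
        ( proj₁ (proj₂ one₁)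
        , subst (λ i → (M₂ at v) i ≡ true) (sym p₁≡p₂) (proj₁ (proj₂ one₂))
        , subst (λ i → (M₃ at v) i ≡ true) (sym (trans p₁≡p₂ p₂≡p₃))
                (proj₁ (proj₂ one₃)))
    ; mult-at = λ i →
        cong₂ _+_ (cong₂ _+_ (cong b2n (bit₁ i)) (cong b2n (bit₂ i))) (cong b2n (bit₃ i))
    ; colour-at = λ i → cong₂ (λ x (yz : Bool × Bool) → tripleColour x (proj₁ yz) (proj₂ yz))
                               (bit₁ i) (cong₂ _,_ (bit₂ i) (bit₃ i))
    }
    where
    one₁ : ExactlyOne (M₁ at v)
    one₁ = to (isPerfectMatching⇔ M₁) perfect₁ v
    one₂ : ExactlyOne (M₂ at v)
    one₂ = to (isPerfectMatching⇔ M₂) perfect₂ v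
    one₃ : ExactlyOne (M₃ at v)
    one₃ = to (isPerfectMatching⇔ M₃) perfect₃ v
    bit₁ : ∀ i → (M₁ at v) i ≡ ⌊ i ≟ proj₁ one₁ ⌋
    bit₁ = exactlyOne-indicator one₁
    bit₂ : ∀ i → (M₂ at v) i ≡ ⌊ i ≟ proj₁ one₂ ⌋
    bit₂ = exactlyOne-indicator one₂
    bit₃ : ∀ i → (M₃ at v) i ≡ ⌊ i ≟ proj₁ one₃ ⌋
    bit₃ = exactlyOne-indicator one₃


  T₀-matching : ∀ {s} → IsFRTriple G s → IsMatching G (inExactly s 0)
  T₀-matching fr = from (isMatching⇔ _) λ v → let open ProfileAt (profileAt fr v) in
    AtMostOne-resp (sym ∘ inExactly-at 0) (profile-T₀-atMostOne p₁ p₂ p₃ notAllEqual)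

  T₂-matching : ∀ {s} → IsFRTriple G s → IsMatching G (inExactly s 2)
  T₂-matching fr = from (isMatching⇔ _) λ v → let open ProfileAt (profileAt fr v) in
    AtMostOne-resp (sym ∘ inExactly-at 2) (profile-T₂-atMostOne p₁ p₂ p₃ notAllEqual)

  T₀-T₂-disjoint : ∀ s → Disjoint {G} (inExactly s 0) (inExactly s 2)
  T₀-T₂-disjoint s e (T₀e , T₂e) =
    contradiction (trans (sym (to (inExactly⇔InT s 0 e) T₀e)) (to (inExactly⇔InT s 2 e) T₂e)) λ ()

  T₀∪T₂-cycles : ∀ {s} → IsFRTriple G s →
    UnionOfDisjointCycles G (_∪ₑ_ {G} (inExactly s 0) (inExactly s 2))
  T₀∪T₂-cycles fr = from (unionOfDisjointCycles⇔ _) λ v i → let open ProfileAt (profileAt fr v) in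
    λ T₀∪T₂ → ExactlyTwo-resp (sym ∘ T₀∪T₂-at)
      (profile-T₀∪T₂-noneOrTwo p₁ p₂ p₃ notAllEqual i (trans (sym (T₀∪T₂-at i)) T₀∪T₂))

module SplitColouring {n m : ℕ} (ends : Fin m → Fin 2 → Fin n) (cubic : Cubic (mkGraph n m ends))
    (s : Triple (mkGraph n m ends)) (fr : IsFRTriple (mkGraph n m ends) s)
    (A B : EdgeSet (mkGraph n m ends))
    (A⇔T₂ : ∀ e → (A e ≡ true) ⇔ InT s 2 e) (B⇔T₀ : ∀ e → (B e ≡ true) ⇔ InT s 0 e) where

  open CubicSlots ends cubic
  open FRProfiles ends cubic
  open Splitting ends cubic A B
  open Equivalence

  -- The edges on the x″ side (the copies a″b″ and the B-edges) form the vertexless loops of the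
  -- suppressed graph, so one colour serves for all of them.
  sideColour : Fin 2 → Fin 3 → Fin 3
  sideColour zero       x = x
  sideColour (suc zero) _ = zero

  splitColour : E SG → Fin 3
  splitColour (e , c) = sideColour (selector e c) (edgeColour s e)

  ProperAt : V SG → Set
  ProperAt x =
    (Degree SG x 2 → (h h′ : HalfEdge SG x) → splitColour (edgeOf h) ≡ splitColour (edgeOf h′)) ×
    (Degree SG x 3 → (h h′ : HalfEdge SG x) →
      splitColour (edgeOf h) ≡ splitColour (edgeOf h′) → SameHalf h h′)

  ¬T₀ : ∀ {e} → B e ≡ false → mult s e ≢ 0
  ¬T₀ Be T₀ = contradiction (trans (sym (from (B⇔T₀ _) T₀)) Be) λ ()

  ¬T₂ : ∀ {e} → A e ≡ false → mult s e ≢ 2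
  ¬T₂ Ae T₂ = contradiction (trans (sym (from (A⇔T₂ _) T₂)) Ae) λ ()

  selector-zero⇒¬B : ∀ {e} (c : Fin (copies (A e))) → selector e c ≡ zero → B e ≡ false
  selector-zero⇒¬B {e} c sel = by-side (A e) refl
    where
    by-side : ∀ a → A e ≡ a → B e ≡ false
    by-side true  Ae =
      ¬-not λ Be → contradiction (trans (sym (to (A⇔T₂ e) Ae)) (to (B⇔T₀ e) Be)) λ ()
    by-side false Ae = unsplitCopy-zero (B e) (trans (sym (selector-unsplit Ae c)) sel)
      where
      unsplitCopy-zero : ∀ b → unsplitCopy b ≡ zero → b ≡ false
      unsplitCopy-zero false _ = refl
      unsplitCopy-zero true  ()

  proper-at-uncovered : ∀ {v} j → Uncovered (A at v) (B at v) → ProperAt (copyAt v j)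
  proper-at-uncovered {v} j free =
    (λ deg₂ → contradiction (degree-unique deg₂ (uncovered-degree j (proj₁ ∘ free))) λ ()) ,
    colours-distinct
    where
    open ProfileAt (profileAt fr v)
    A-free : ∀ (x : HalfEdge SG (copyAt v j)) → A (proj₁ (proj₁ x)) ≡ false
    A-free x = trans (sym (at-slotOf A (base x))) (proj₁ (free (slotOf (base x))))
    B-free : ∀ (x : HalfEdge SG (copyAt v j)) → B (proj₁ (proj₁ x)) ≡ false
    B-free x = trans (sym (at-slotOf B (base x))) (proj₂ (free (slotOf (base x))))
    colour-slot : ∀ x → splitColour (edgeOf x) ≡ profileColour p₁ p₂ p₃ (slotOf (base x))
    colour-slot x@((e , c) , _) =
      trans (cong (λ j → sideColour j (edgeColour s e))
                  (trans (selector-unsplit (A-free x) c) (cong unsplitCopy (B-free x))))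
            (trans (cong (edgeColour s) (sym (edgeAt-slotOf (base x)))) (colour-at (slotOf (base x))))
    T₁ : ∀ i → profileMult p₁ p₂ p₃ i ≢ 0 × profileMult p₁ p₂ p₃ i ≢ 2
    T₁ i = (λ T₀ → ¬T₀ (proj₂ (free i)) (trans (mult-at i) T₀)) ,
           (λ T₂ → ¬T₂ (proj₁ (free i)) (trans (mult-at i) T₂))
    colours-distinct : Degree SG (copyAt v j) 3 → (h h′ : HalfEdge SG (copyAt v j)) →
      splitColour (edgeOf h) ≡ splitColour (edgeOf h′) → SameHalf h h′
    colours-distinct _ h h′ same = ≡⇒SameHalf (split-half-≡
      (profile-colour-injective-on-T₁ p₁ p₂ p₃ notAllEqual i i′
        (proj₁ (T₁ i)) (proj₂ (T₁ i)) (proj₁ (T₁ i′)) (proj₂ (T₁ i′))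
        (trans (sym (colour-slot h)) (trans same (colour-slot h′))))
      (trans (widen-false (A-free h) _) (sym (widen-false (A-free h′) _))))
      where
      i i′ : Fin 3
      i = slotOf (base h)
      i′ = slotOf (base h′)

  proper-at-covered : ∀ {v} j → Covered (A at v) (B at v) → ProperAt (copyAt v j)
  proper-at-covered {v} j cov =
    (λ _ h h′ → trans (colour-side h) (sym (colour-side h′))) ,
    (λ deg₃ → contradiction (degree-unique (covered-degree j cov) deg₃) λ ())
    where
    open Covered cov
    open ProfileAt (profileAt fr v)
    matches-a : ∀ (x : HalfEdge SG (copyAt v j)) →
      selector (proj₁ (proj₁ x)) (proj₂ (proj₁ x)) ≡ zero →
      edgeColour s (proj₁ (proj₁ x)) ≡ edgeColour s (edgeAt v a)
    matches-a x@((e , c) , _) sel = trans (cong (edgeColour s) (sym (edgeAt-slotOf (base x))))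
      (trans (colour-at i)
        (trans (sym (profile-colour-T₂≡non-T₀ p₁ p₂ p₃ a i T₂-a ¬T₀-i)) (sym (colour-at a))))
      where
      i : Fin 3
      i = slotOf (base x)
      T₂-a : profileMult p₁ p₂ p₃ a ≡ 2
      T₂-a = trans (sym (mult-at a)) (to (A⇔T₂ _) α-a)
      ¬T₀-i : profileMult p₁ p₂ p₃ i ≢ 0
      ¬T₀-i T₀ = ¬T₀ (selector-zero⇒¬B c sel)
        (trans (cong (mult s) (sym (edgeAt-slotOf (base x)))) (trans (mult-at i) T₀))
    colour-side : ∀ x → splitColour (edgeOf x) ≡ sideColour j (edgeColour s (edgeAt v a))
    colour-side x@((e , c) , _) =
      on-side j (pick-true-injective (covered-true (halfEdgeAt v a) α-a) (base-selector x))
      where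
      on-side : ∀ j → selector e c ≡ j →
        splitColour (e , c) ≡ sideColour j (edgeColour s (edgeAt v a))
      on-side zero       sel = trans (cong (λ j → sideColour j (edgeColour s e)) sel) (matches-a x sel)
      on-side (suc zero) sel = cong (λ j → sideColour j (edgeColour s e)) sel

  colourable : (∀ v → Configuration (A at v) (B at v)) → SuppressedThreeEdgeColourable SG
  colourable config = splitColour , at-every-copy ProperAt proper-at
    where
    proper-at : ∀ v j → ProperAt (copyAt v j)
    proper-at v j with config v
    ... | inj₁ free = proper-at-uncovered j free
    ... | inj₂ cov  = proper-at-covered j cov

module ColouringTriple {n m : ℕ} (ends : Fin m → Fin 2 → Fin n) (cubic : Cubic (mkGraph n m ends))
    (A B : EdgeSet (mkGraph n m ends)) (disjoint : Disjoint {mkGraph n m ends} A B)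
    (c : E (Split ends A B) → Fin 3) (proper : SuppressedColouring (Split ends A B) c) where

  open CubicSlots ends cubic
  open Splitting ends cubic A B

  colourOf : Fin m → Fin 3
  colourOf e = c (e , pick (A e) zero)

  member : Fin 3 → EdgeSet G
  member k e = slotMember (B e) (A e) (colourOf e) k

  colourTriple : Triple G
  colourTriple = triple (member zero) (member (suc zero)) (member (suc (suc zero)))

  mult-colourTriple : ∀ e → mult colourTriple e ≡ expectedMult (B e) (A e)
  mult-colourTriple e = slotMember-count (B e) (A e) (colourOf e)

  T₀⇔B : ∀ e → InT colourTriple 0 e ⇔ (B e ≡ true)
  T₀⇔B e = subst (λ x → (x ≡ 0) ⇔ (B e ≡ true)) (sym (mult-colourTriple e))
    (expectedMult≡0⇔ (B e) (A e))

  T₂⇔A : ∀ e → InT colourTriple 2 e ⇔ (A e ≡ true)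
  T₂⇔A e = subst (λ x → (x ≡ 2) ⇔ (A e ≡ true)) (sym (mult-colourTriple e))
    (expectedMult≡2⇔ (B e) (A e) (disjoint e))

  member-uncovered : ∀ {v} k → Uncovered (A at v) (B at v) → ExactlyOne (member k at v)
  member-uncovered {v} k free =
    ExactlyOne-resp (λ i → sym (cong₂ (λ inB inA → slotMember inB inA (colourOf (edgeAt v i)) k)
                                      (proj₂ (free i)) (proj₁ (free i))))
      (injective⇒exactlyOne colours-injective k)
    where
    degree₃ : Degree SG (copyAt v zero) 3
    degree₃ = uncovered-degree zero (proj₁ ∘ free)
    open Inverse degree₃
    colours-injective : ∀ {i i′} → colourOf (edgeAt v i) ≡ colourOf (edgeAt v i′) → i ≡ i′
    colours-injective {i} {i′} same = trans (sym (strictlyInverseʳ i))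
      (trans (cong from (SameHalf⇒≡ _≟ˢ_ (proj₂ (proper (copyAt v zero)) degree₃ (to i) (to i′) same)))
             (strictlyInverseʳ i′))

  member-covered : ∀ {v} k → Covered (A at v) (B at v) → ExactlyOne (member k at v)
  member-covered {v} k cov = by-hit ⌊ colourOf (edgeAt v a) ≟ k ⌋ refl
    where
    open Covered cov
    degree₂ : Degree SG (copyAt v zero) 2
    degree₂ = covered-degree zero cov
    a-matches-t : colourOf (edgeAt v a) ≡ colourOf (edgeAt v t)
    a-matches-t = proj₁ (proper (copyAt v zero)) degree₂
      (Inverse.to degree₂ zero) (Inverse.to degree₂ (suc zero))
    member-a : (member k at v) a ≡ not ⌊ colourOf (edgeAt v a) ≟ k ⌋
    member-a = cong₂ (λ inB inA → slotMember inB inA (colourOf (edgeAt v a)) k) β-a α-a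
    member-b : (member k at v) b ≡ false
    member-b = cong (λ inB → slotMember inB (A (edgeAt v b)) (colourOf (edgeAt v b)) k) β-b
    member-t : (member k at v) t ≡ ⌊ colourOf (edgeAt v a) ≟ k ⌋
    member-t = trans (cong₂ (λ inB inA → slotMember inB inA (colourOf (edgeAt v t)) k) β-t α-t)
                     (cong (λ x → ⌊ x ≟ k ⌋) (sym a-matches-t))
    by-hit : ∀ hit → ⌊ colourOf (edgeAt v a) ≟ k ⌋ ≡ hit → ExactlyOne (member k at v)
    by-hit true hit = exactlyOne-at (distinct₃-reverse distinct)
      (trans member-t hit) member-b (trans member-a (cong not hit))
    by-hit false miss = exactlyOne-at distinct
      (trans member-a (cong not miss)) member-b (trans member-t miss)

  colourTriple-FR : (∀ v → Configuration (A at v) (B at v)) → IsFRTriple G colourTriple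
  colourTriple-FR config = perfect zero , perfect (suc zero) , perfect (suc (suc zero)) , not-all
    where
    perfect : ∀ k → IsPerfectMatching G (member k)
    perfect k = Equivalence.from (isPerfectMatching⇔ (member k))
      λ v → [ member-uncovered k , member-covered k ] (config v)
    not-all : ∀ e →
      ¬ (member zero e ≡ true × member (suc zero) e ≡ true × member (suc (suc zero)) e ≡ true)
    not-all e (in₁ , in₂ , in₃) = expectedMult≢3 (B e) (A e)
      (trans (sym (mult-colourTriple e))
             (cong₂ _+_ (cong₂ _+_ (cong b2n in₁) (cong b2n in₂)) (cong b2n in₃)))

module Characterisation {n m : ℕ} (ends : Fin m → Fin 2 → Fin n) (cubic : Cubic (mkGraph n m ends)) where

  open CubicSlots ends cubic
  open FRProfiles ends cubic

  Splittable : Set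
  Splittable = Σ[ A₁ ∈ (Fin m → Bool) ] Σ[ A₂ ∈ (Fin m → Bool) ]
    (IsMatching G A₁ × IsMatching G A₂ × Disjoint {G} A₁ A₂ ×
     UnionOfDisjointCycles G (_∪ₑ_ {G} A₁ A₂) ×
     SuppressedThreeEdgeColourable (Split ends A₁ A₂) ×
     SuppressedThreeEdgeColourable (Split ends A₂ A₁))

  compatible⇒splittable : HasTwoCompatibleFRTriples G → Splittable
  compatible⇒splittable (t , t′ , fr , fr′ , T₀≡T′₂ , T₂≡T′₀) =
    A₁ , A₂ , T₀-matching fr , T₂-matching fr , T₀-T₂-disjoint t , T₀∪T₂-cycles fr ,
    SplitColouring.colourable ends cubic t′ fr′ A₁ A₂
      (λ e → T₀≡T′₂ e ⇔-∘ inExactly⇔InT t 0 e) (λ e → T₂≡T′₀ e ⇔-∘ inExactly⇔InT t 2 e)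
      config ,
    SplitColouring.colourable ends cubic t fr A₂ A₁
      (inExactly⇔InT t 2) (inExactly⇔InT t 0) (swap-configuration ∘ config)
    where
    A₁ A₂ : EdgeSet G
    A₁ = inExactly t 0
    A₂ = inExactly t 2
    config : ∀ v → Configuration (A₁ at v) (A₂ at v)
    config = configurationAt (T₀-matching fr) (T₂-matching fr) (T₀-T₂-disjoint t)
                             (T₀∪T₂-cycles fr)

  splittable⇒compatible : Splittable → HasTwoCompatibleFRTriples G
  splittable⇒compatible
    (A₁ , A₂ , A₁-matching , A₂-matching , disjoint , cycles , (c₁ , proper₁) , (c₂ , proper₂)) =
    s₂.colourTriple , s₁.colourTriple ,
    s₂.colourTriple-FR (swap-configuration ∘ config) , s₁.colourTriple-FR config ,
    (λ e → ⇔-sym (s₁.T₂⇔A e) ⇔-∘ s₂.T₀⇔B e) ,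
    (λ e → ⇔-sym (s₁.T₀⇔B e) ⇔-∘ s₂.T₂⇔A e)
    where
    config : ∀ v → Configuration (A₁ at v) (A₂ at v)
    config = configurationAt A₁-matching A₂-matching disjoint cycles
    module s₁ = ColouringTriple ends cubic A₁ A₂ disjoint c₁ proper₁
    module s₂ = ColouringTriple ends cubic A₂ A₁
                  (λ e (A₂e , A₁e) → disjoint e (A₁e , A₂e)) c₂ proper₂

proposition2p6 : (n m : ℕ) (ends : Fin m → Fin 2 → Fin n) →
    Cubic (mkGraph n m ends) → Bridgeless (mkGraph n m ends) →
    HasTwoCompatibleFRTriples (mkGraph n m ends) ⇔
      (Σ[ A₁ ∈ (Fin m → Bool) ] Σ[ A₂ ∈ (Fin m → Bool) ]
        (IsMatching (mkGraph n m ends) A₁ × IsMatching (mkGraph n m ends) A₂ ×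
         Disjoint {mkGraph n m ends} A₁ A₂ ×
         UnionOfDisjointCycles (mkGraph n m ends) (_∪ₑ_ {mkGraph n m ends} A₁ A₂) ×
         SuppressedThreeEdgeColourable (Split ends A₁ A₂) ×
         SuppressedThreeEdgeColourable (Split ends A₂ A₁)))
proposition2p6 n m ends cubic _ = mk⇔ compatible⇒splittable splittable⇒compatible
  where open Characterisation ends cubic
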